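{- Let $\mathscr C \le \mathbb F_q^n$ be a linear code (an $\mathbb F_q$-linear subspace), and let $\kappa(\mathscr C)$ denote the vertical connectivity of the matroid associated with $\mathscr C$. Then $\mathscr C$ is intersecting if and only if $\kappa(\mathscr C)=\dim(\mathscr C)$.
   Context: For $x\in\mathbb F_q^n$, the Hamming support is $\sigma(x)=\{i\in[n]: x_i\neq 0\}$. A code $\mathscr C$ is intersecting if $\sigma(v)\cap\sigma(w)\neq\emptyset$ for all nonzero $v,w\in\mathscr C$. The matroid associated with $\mathscr C$ is $M=([n],r)$ where, for a generator matrix $G$ of $\mathscr C$ (a $k\times n$ matrix whose rows form a basis of $\mathscr C$) and $A\subseteq[n]$, $r(A)$ is the rank of the submatrix of $G$ formed by the columns indexed by $A$ (this does not depend on the choice of $G$). For a matroid $M=(E,r)$, the connectivity function is $\lambda_M(X)=r(X)+r(E\setminus X)-r(E)$. For a positive integer $t$, a partition $(X,E\setminus X)$ of $E$ is a vertical $t$-separation if $\lambda_M(X)<t$ and $\min\{r(X),r(E\setminus X)\}\ge t$. The vertical connectivity $\kappa(M)$ is the minimum $t$ such that $M$ has a vertical $t$-separation; if $M$ has no vertical separation, $\kappa(M)=r(E)$. -}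

module Defs where

open import Level using (Level; _⊔_) renaming (suc to lsuc)
open import Data.Nat using (ℕ; zero; suc; _≤_; _<_) renaming (_+_ to _+ℕ_; _∸_ to _∸ℕ_)
open import Data.Fin using (Fin; zero; suc)
open import Data.Fin.Subset using (Subset; _∈_; ∁; ⊤)
open import Data.Product using (Σ; ∃; _×_; _,_)
open import Data.Sum using (_⊎_)
open import Relation.Nullary using (¬_)
open import Relation.Binary using (Decidable)
open import Relation.Binary.PropositionalEquality using (_≡_)
open import Algebra.Bundles using (CommutativeRing)

record FiniteField (c ℓ : Level) : Set (lsuc (c ⊔ ℓ)) where
  field
    commRing : CommutativeRing c ℓ
  open CommutativeRing commRing public
  field
    0≉1       : ¬ (0# ≈ 1#)
    inverse   : ∀ x → ¬ (x ≈ 0#) → ∃ λ y → x * y ≈ 1#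
    _≟_       : Decidable _≈_
    q         : ℕ
    enum      : Fin q → Carrier
    enum-surj : ∀ x → ∃ λ i → enum i ≈ x
    enum-inj  : ∀ i j → enum i ≈ enum j → i ≡ j

module Code {c ℓ : Level} (F : FiniteField c ℓ) where
  open FiniteField F using (Carrier; _≈_; _+_; _*_; 0#)

  Vector : ℕ → Set c
  Vector n = Fin n → Carrier

  Matrix : ℕ → ℕ → Set c
  Matrix k n = Fin k → Fin n → Carrier

  sumF : ∀ {m} → (Fin m → Carrier) → Carrier
  sumF {zero}  f = 0#
  sumF {suc m} f = f zero + sumF (λ i → f (suc i))

  record Subspace {p : Level} (n : ℕ) : Set (c ⊔ ℓ ⊔ lsuc p) where
    field
      Mem      : Vector n → Set p
      Mem-resp : ∀ {v w} → (∀ i → v i ≈ w i) → Mem v → Mem w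
      Mem-0    : Mem (λ _ → 0#)
      Mem-+    : ∀ {v w} → Mem v → Mem w → Mem (λ i → v i + w i)
      Mem-*    : ∀ a {v} → Mem v → Mem (λ i → a * v i)

  NonZeroVec : ∀ {n} → Vector n → Set ℓ
  NonZeroVec v = ¬ (∀ i → v i ≈ 0#)

  SupportsMeet : ∀ {n} → Vector n → Vector n → Set ℓ
  SupportsMeet v w = ∃ λ i → ¬ (v i ≈ 0#) × ¬ (w i ≈ 0#)

  Intersecting : ∀ {p n} → Subspace {p} n → Set (c ⊔ ℓ ⊔ p)
  Intersecting C = ∀ v w → Mem v → Mem w → NonZeroVec v → NonZeroVec w
                   → SupportsMeet v w
    where open Subspace C

  InRowSpan : ∀ {k n} → Matrix k n → Vector n → Set (c ⊔ ℓ)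
  InRowSpan {k} G v = ∃ λ (a : Fin k → Carrier) → ∀ j → v j ≈ sumF (λ i → a i * G i j)

  RowsIndependent : ∀ {k n} → Matrix k n → Set (c ⊔ ℓ)
  RowsIndependent {k} G = ∀ (a : Fin k → Carrier)
    → (∀ j → sumF (λ i → a i * G i j) ≈ 0#) → ∀ i → a i ≈ 0#

  -- G is a generator matrix of C: its rows form a basis of C (so dim C = k)
  IsGeneratorMatrix : ∀ {p k n} → Subspace {p} n → Matrix k n → Set (c ⊔ ℓ ⊔ p)
  IsGeneratorMatrix C G =
    RowsIndependent G × (∀ v → (Mem v → InRowSpan G v) × (InRowSpan G v → Mem v))
    where open Subspace C

  ColumnsIndependent : ∀ {k n m} → Matrix k n → (Fin m → Fin n) → Set (c ⊔ ℓ)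
  ColumnsIndependent {k} {n} {m} G js = ∀ (a : Fin m → Carrier)
    → (∀ i → sumF (λ l → a l * G i (js l)) ≈ 0#) → ∀ l → a l ≈ 0#

  IndepFamilyIn : ∀ {k n} → Matrix k n → Subset n → ℕ → Set (c ⊔ ℓ)
  IndepFamilyIn {n = n} G X m = Σ (Fin m → Fin n) λ js →
    (∀ l l′ → js l ≡ js l′ → l ≡ l′) × (∀ l → js l ∈ X) × ColumnsIndependent G js

  IsRank : ∀ {k n} → Matrix k n → Subset n → ℕ → Set (c ⊔ ℓ)
  IsRank G X r = IndepFamilyIn G X r × (∀ m → IndepFamilyIn G X m → m ≤ r)

  IsVerticalSeparation : ∀ {k n} → Matrix k n → Subset n → ℕ → Set (c ⊔ ℓ)
  IsVerticalSeparation G X t =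
    1 ≤ t × ∃ λ rX → ∃ λ rY → ∃ λ rE →
      IsRank G X rX × IsRank G (∁ X) rY × IsRank G ⊤ rE ×
      (rX +ℕ rY ∸ℕ rE < t) × t ≤ rX × t ≤ rY

  HasVerticalSeparation : ∀ {k n} → Matrix k n → ℕ → Set (c ⊔ ℓ)
  HasVerticalSeparation {n = n} G t = ∃ λ (X : Subset n) → IsVerticalSeparation G X t

  IsVerticalConnectivity : ∀ {k n} → Matrix k n → ℕ → Set (c ⊔ ℓ)
  IsVerticalConnectivity G κ =
      (HasVerticalSeparation G κ × (∀ t → HasVerticalSeparation G t → κ ≤ t))
    ⊎ ((∀ t → ¬ HasVerticalSeparation G t) × IsRank G ⊤ κ)

{-# OPTIONS --safe #-}
-- The rows of the generator matrix G are independent, so r(E) = k in the column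
-- matroid. A nonzero codeword aG vanishes on a set X of coordinates iff a annihilates
-- every column in X, and such an a ≠ 0 exists iff r(X) < k. Nonzero codewords with
-- disjoint supports are the same as nonzero codewords vanishing on X and on E∖X
-- respectively (take X to be the zero set of the first one); hence they exist iff
-- 1 ≤ r(X) < k and 1 ≤ r(E∖X) < k, which is exactly when (X, E∖X) is a vertical
-- t-separation for some t, e.g. t = min(r(X), r(E∖X)). So C is intersecting iff the
-- matroid has no vertical separation at all, i.e. iff κ = r(E) = k: a vertical
-- k-separation cannot exist, since every vertical t-separation has t ≤ r(X) < r(E).
--
-- Ranks exist constructively because linear dependence over a finite field can be
-- decided by exhaustive search; that independent families in F^k have at most k
-- members is proved by Gaussian elimination.
module Submission where

open import Defs
open import Level using (Level; _⊔_)
open import Data.Nat using (ℕ; zero; suc; z≤n; s≤s; _≤_; _<_; _⊓_)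
open import Data.Nat.Properties as ℕ using (≤-<-trans; <-≤-trans; ≰⇒>; m⊓n≤m; m⊓n≤n; ⊓-glb)
open import Data.Fin using (Fin; zero; suc; punchIn; punchOut)
import Data.Fin.Properties as Fin
open import Data.Fin.Properties using (any?; all?; ¬∀⟶∃¬; punchIn-punchOut)
open import Data.Fin.Subset using (Subset; _∈_; ∁; ⊤)
open import Data.Fin.Subset.Properties using (_∈?_; ∈⊤; x∉p⇒x∈∁p; x∈∁p⇒x∉p)
open import Data.Vec using (tabulate)
open import Data.Vec.Properties using ([]=⇒lookup; lookup⇒[]=; lookup∘tabulate)
open import Data.Vec.Functional using (_∷_)
open import Data.Bool.Properties using (T-≡)
open import Data.Product using (∃; ∃₂; _×_; _,_; proj₁; proj₂)
open import Data.Sum using (_⊎_; inj₁; inj₂; [_,_]′)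
open import Data.Empty using (⊥-elim)
open import Function using (_∘_)
open import Function.Bundles using (_⇔_; mk⇔; Equivalence)
open import Function.Construct.Composition using (_⇔-∘_)
open import Relation.Nullary using (¬_; Dec; yes; no)
open import Relation.Nullary.Decidable
  using (¬?; _×-dec_; _→-dec_; map′; decidable-stable; isYes; toWitness; fromWitness)
open import Relation.Unary using (Pred; Decidable)
open import Relation.Binary using (Setoid)
open import Relation.Binary.Definitions using (_Respects_)
open import Relation.Binary.PropositionalEquality as ≡ using (_≡_)

module FiniteSearch {a ℓ} (S : Setoid a ℓ) {q : ℕ}
  (enum : Fin q → Setoid.Carrier S)
  (enum-surj : ∀ x → ∃ λ i → Setoid._≈_ S (enum i) x) where

  open Setoid S
  open import Data.Vec.Functional.Relation.Binary.Equality.Setoid S using (_≋_)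

  ∃-vector? : ∀ m {p} {P : Pred (Fin m → Carrier) p} → P Respects _≋_ → Decidable P → Dec (∃ P)
  ∃-vector? zero resp P? = map′ (_ ,_) (λ (_ , Pf) → resp (λ ()) Pf) (P? (λ ()))
  ∃-vector? (suc m) {P = P} resp P? =
    map′ (λ (i , g , Pg) → enum i ∷ g , Pg) from
      (any? λ i → ∃-vector? m (resp ∘ ∷-cong) (P? ∘ (enum i ∷_)))
    where
    ∷-cong : ∀ {x} {g h : Fin m → Carrier} → g ≋ h → (x ∷ g) ≋ (x ∷ h)
    ∷-cong g≋h zero    = refl
    ∷-cong g≋h (suc l) = g≋h l
    from : ∃ P → ∃ λ i → ∃ λ g → P (enum i ∷ g)
    from (f , Pf) with enum-surj (f zero)
    ... | i , eᵢ≈f₀ = i , f ∘ suc , resp (λ { zero → sym eᵢ≈f₀ ; (suc l) → refl }) Pf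

greatest-below : ∀ {p} {P : Pred ℕ p} → Decidable P → P 0 → ∀ b → (∀ m → P m → m ≤ b)
  → ∃ λ r → P r × (∀ m → P m → m ≤ r)
greatest-below         P? P0 zero    bound = 0 , P0 , bound
greatest-below {P = P} P? P0 (suc b) bound with P? (suc b)
... | yes Pb = suc b , Pb , bound
... | no ¬Pb = greatest-below P? P0 b bound′
  where
  bound′ : ∀ m → P m → m ≤ b
  bound′ m Pm with ℕ.m≤n⇒m<n∨m≡n (bound m Pm)
  ... | inj₁ (s≤s m≤b) = m≤b
  ... | inj₂ ≡.refl     = ⊥-elim (¬Pb Pm)

punchIn-cases : ∀ {n p} {P : Pred (Fin (suc n)) p} i → P i → (∀ j → P (punchIn i j)) → ∀ j → P j
punchIn-cases {P = P} i Pi P∘punchIn j with i Fin.≟ j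
... | yes ≡.refl = Pi
... | no i≢j     = ≡.subst P (punchIn-punchOut i≢j) (P∘punchIn (punchOut i≢j))

module _ where

  open import Data.Nat using (_+_; _∸_)
  open ℕ.≤-Reasoning

  x+y∸e<t⇒x<e×y<e : ∀ {x y e t} → t ≤ x → t ≤ y → x + y ∸ e < t → x < e × y < e
  x+y∸e<t⇒x<e×y<e {x} {y} {e} {t} t≤x t≤y x+y∸e<t =
    x<e t≤y x+y∸e<t , x<e t≤x (≡.subst (λ s → s ∸ e < t) (ℕ.+-comm x y) x+y∸e<t)
    where
    x<e : ∀ {x y} → t ≤ y → x + y ∸ e < t → x < e
    x<e {x} {y} t≤y x+y∸e<t with e ℕ.≤? x
    ... | no  e≰x = ≰⇒> e≰x
    ... | yes e≤x = ⊥-elim (ℕ.<⇒≱ x+y∸e<t (begin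
      t          ≤⟨ t≤y ⟩
      y          ≤⟨ ℕ.m≤n+m y (x ∸ e) ⟩
      x ∸ e + y  ≡⟨ ℕ.+-∸-comm y e≤x ⟨
      x + y ∸ e  ∎))

  x+y∸e<x⊓y : ∀ {x y e} → 1 ≤ x → 1 ≤ y → x < e → y < e → x + y ∸ e < x ⊓ y
  x+y∸e<x⊓y {x} {y} {e} 1≤x 1≤y x<e y<e =
    ⊓-glb (below 1≤x y<e) (≡.subst (λ s → s ∸ e < y) (ℕ.+-comm y x) (below 1≤y x<e))
    where
    below : ∀ {x y} → 1 ≤ x → y < e → x + y ∸ e < x
    below {suc x} {y} _ y<e = s≤s (begin
      suc x + y ∸ e      ≤⟨ ℕ.∸-monoʳ-≤ (suc x + y) y<e ⟩
      suc x + y ∸ suc y  ≡⟨ ℕ.m+n∸n≡m x y ⟩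
      x                  ∎)

module LinearAlgebra {c ℓ} (F : FiniteField c ℓ) where

  open FiniteField F hiding (zero)
  open Code F
  open import Algebra.Properties.Ring ring using (-‿distribˡ-*; -‿distribʳ-*)
  open import Algebra.Properties.Group +-group using (inverseˡ-unique)
  open import Algebra.Properties.CommutativeSemigroup *-commutativeSemigroup using (x∙yz≈y∙xz)
  open import Algebra.Properties.Semiring.Sum semiring
    using (sum; sum-cong-≋; sum-replicate-zero; ∑-distrib-+; ∑-comm; *-distribˡ-sum; *-distribʳ-sum)
  open import Relation.Binary.Reasoning.Setoid setoid

  x*y≈0⇒x≈0 : ∀ {x y} → ¬ y ≈ 0# → x * y ≈ 0# → x ≈ 0#
  x*y≈0⇒x≈0 {x} {y} y≉0 xy≈0 with inverse y y≉0
  ... | y⁻¹ , yy⁻¹≈1 = begin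
    x              ≈⟨ *-identityʳ x ⟨
    x * 1#         ≈⟨ *-congˡ yy⁻¹≈1 ⟨
    x * (y * y⁻¹)  ≈⟨ *-assoc x y y⁻¹ ⟨
    (x * y) * y⁻¹  ≈⟨ *-congʳ xy≈0 ⟩
    0# * y⁻¹       ≈⟨ zeroˡ y⁻¹ ⟩
    0#             ∎

  sumF≡sum : ∀ {m} (f : Vector m) → sumF f ≡ sum f
  sumF≡sum {zero}  f = ≡.refl
  sumF≡sum {suc m} f = ≡.cong (f zero +_) (sumF≡sum (f ∘ suc))

  sumF-cong : ∀ {m} {f g : Vector m} → (∀ i → f i ≈ g i) → sumF f ≈ sumF g
  sumF-cong {f = f} {g} f≈g rewrite sumF≡sum f | sumF≡sum g = sum-cong-≋ f≈g

  sumF-zero : ∀ {m} {f : Vector m} → (∀ i → f i ≈ 0#) → sumF f ≈ 0#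
  sumF-zero {m} {f} f≈0 rewrite sumF≡sum f = trans (sum-cong-≋ f≈0) (sum-replicate-zero m)

  sumF-+ : ∀ {m} (f g : Vector m) → sumF (λ i → f i + g i) ≈ sumF f + sumF g
  sumF-+ f g rewrite sumF≡sum (λ i → f i + g i) | sumF≡sum f | sumF≡sum g = ∑-distrib-+ f g

  sumF-*ˡ : ∀ {m} x (f : Vector m) → sumF (λ i → x * f i) ≈ x * sumF f
  sumF-*ˡ x f rewrite sumF≡sum (λ i → x * f i) | sumF≡sum f = sym (*-distribˡ-sum x f)

  sumF-*ʳ : ∀ {m} x (f : Vector m) → sumF (λ i → f i * x) ≈ sumF f * x
  sumF-*ʳ x f rewrite sumF≡sum (λ i → f i * x) | sumF≡sum f = sym (*-distribʳ-sum x f)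

  sumF-comm : ∀ {m k} (h : Fin m → Fin k → Carrier)
    → sumF (λ i → sumF (h i)) ≈ sumF (λ l → sumF (λ i → h i l))
  sumF-comm h = begin
    sumF (λ i → sumF (h i))          ≈⟨ sumF-cong (λ i → reflexive (sumF≡sum (h i))) ⟩
    sumF (λ i → sum (h i))           ≡⟨ sumF≡sum (λ i → sum (h i)) ⟩
    sum (λ i → sum (h i))            ≈⟨ ∑-comm h ⟩
    sum (λ l → sum (λ i → h i l))    ≡⟨ sumF≡sum (λ l → sum (λ i → h i l)) ⟨
    sumF (λ l → sum (λ i → h i l))   ≈⟨ sumF-cong (λ l → reflexive (sumF≡sum (λ i → h i l))) ⟨
    sumF (λ l → sumF (λ i → h i l))  ∎

  IsZero : ∀ {m} → Vector m → Set ℓ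
  IsZero v = ∀ i → v i ≈ 0#

  lincomb : ∀ {m k} → Vector m → (Fin m → Vector k) → Vector k
  lincomb a V i = sumF (λ l → a l * V l i)

  infix 7 _·_
  _·_ : ∀ {k} → Vector k → Vector k → Carrier
  a · x = sumF (λ i → a i * x i)

  δ : ∀ {m} → Fin m → Vector m
  δ zero    zero    = 1#
  δ zero    (suc _) = 0#
  δ (suc _) zero    = 0#
  δ (suc i) (suc j) = δ i j

  δ-diag : ∀ {m} (i : Fin m) → δ i i ≈ 1#
  δ-diag zero    = refl
  δ-diag (suc i) = δ-diag i

  sumF-δ : ∀ {m} (l : Fin m) (f : Vector m) → sumF (λ l′ → δ l l′ * f l′) ≈ f l
  sumF-δ {suc m} zero f = begin
    1# * f zero + sumF (λ l′ → 0# * f (suc l′))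
      ≈⟨ +-cong (*-identityˡ _) (sumF-zero {m} (λ l′ → zeroˡ _)) ⟩
    f zero + 0#
      ≈⟨ +-identityʳ _ ⟩
    f zero
      ∎
  sumF-δ {suc m} (suc l) f = begin
    0# * f zero + sumF (λ l′ → δ l l′ * f (suc l′))
      ≈⟨ +-cong (zeroˡ _) (sumF-δ l (f ∘ suc)) ⟩
    0# + f (suc l)
      ≈⟨ +-identityˡ _ ⟩
    f (suc l)
      ∎

  lincomb-cong : ∀ {m k} {a b : Vector m} (V : Fin m → Vector k)
    → (∀ l → a l ≈ b l) → ∀ i → lincomb a V i ≈ lincomb b V i
  lincomb-cong V a≈b i = sumF-cong (λ l → *-congʳ (a≈b l))

  lincomb-zeroˡ : ∀ {m k} {a : Vector m} (V : Fin m → Vector k) → IsZero a → IsZero (lincomb a V)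
  lincomb-zeroˡ V a≈0 i = sumF-zero (λ l → trans (*-congʳ (a≈0 l)) (zeroˡ _))

  lincomb-* : ∀ {m k} s (a : Vector m) (V : Fin m → Vector k) i
    → lincomb (λ l → s * a l) V i ≈ s * lincomb a V i
  lincomb-* s a V i =
    trans (sumF-cong (λ l → *-assoc s (a l) (V l i))) (sumF-*ˡ s (λ l → a l * V l i))

  lincomb-δ : ∀ {m k} (l : Fin m) (V : Fin m → Vector k) i → lincomb (δ l) V i ≈ V l i
  lincomb-δ l V i = sumF-δ l (λ l′ → V l′ i)

  ·-zeroʳ : ∀ {k} (a : Vector k) {x} → IsZero x → a · x ≈ 0#
  ·-zeroʳ a x≈0 = sumF-zero (λ i → trans (*-congˡ (x≈0 i)) (zeroʳ _))

  ·-δ : ∀ {k} (a : Vector k) i → a · δ i ≈ a i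
  ·-δ a i = trans (sumF-cong (λ j → *-comm (a j) (δ i j))) (sumF-δ i a)

  ·-lincomb : ∀ {m k} (a : Vector k) (b : Vector m) (V : Fin m → Vector k)
    → a · lincomb b V ≈ b · (λ l → a · V l)
  ·-lincomb a b V = begin
    a · lincomb b V
      ≈⟨ sumF-cong (λ i → sumF-*ˡ (a i) (λ l → b l * V l i)) ⟨
    sumF (λ i → sumF (λ l → a i * (b l * V l i)))
      ≈⟨ sumF-comm (λ i l → a i * (b l * V l i)) ⟩
    sumF (λ l → sumF (λ i → a i * (b l * V l i)))
      ≈⟨ sumF-cong (λ l → sumF-cong (λ i → x∙yz≈y∙xz (a i) (b l) (V l i))) ⟩
    sumF (λ l → sumF (λ i → b l * (a i * V l i)))
      ≈⟨ sumF-cong (λ l → sumF-*ˡ (b l) (λ i → a i * V l i)) ⟩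
    b · (λ l → a · V l)
      ∎

  Independent : ∀ {m k} → (Fin m → Vector k) → Set (c ⊔ ℓ)
  Independent V = ∀ a → IsZero (lincomb a V) → IsZero a

  Dependent : ∀ {m k} → (Fin m → Vector k) → Set (c ⊔ ℓ)
  Dependent V = ∃ λ a → NonZeroVec a × IsZero (lincomb a V)

  infix 4 _∈Span_
  _∈Span_ : ∀ {m k} → Vector k → (Fin m → Vector k) → Set (c ⊔ ℓ)
  x ∈Span V = ∃ λ b → ∀ i → x i ≈ lincomb b V i

  independent⇒nonzero : ∀ {m k} {V : Fin m → Vector k}
    → Independent V → ∀ l → NonZeroVec (V l)
  independent⇒nonzero {V = V} ind l Vl≈0 =
    0≉1 (trans (sym (ind (δ l) (λ i → trans (lincomb-δ l V i) (Vl≈0 i)) l)) (δ-diag l))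

  ∷-relation-trivial : ∀ {m k} {x : Vector k} {V : Fin m → Vector k} → Independent V
    → ∀ a → IsZero (lincomb a (x ∷ V)) → a zero ≈ 0# → IsZero a
  ∷-relation-trivial ind a rel a₀≈0 zero = a₀≈0
  ∷-relation-trivial {x = x} {V} ind a rel a₀≈0 (suc l) = ind (a ∘ suc) tail-rel l
    where
    tail-rel : IsZero (lincomb (a ∘ suc) V)
    tail-rel i = begin
      lincomb (a ∘ suc) V i                 ≈⟨ +-identityˡ _ ⟨
      0# + lincomb (a ∘ suc) V i            ≈⟨ +-congʳ (trans (*-congʳ a₀≈0) (zeroˡ (x i))) ⟨
      a zero * x i + lincomb (a ∘ suc) V i  ≈⟨ rel i ⟩
      0#                                    ∎

  dependent-∷⇒∈Span : ∀ {m k} {x : Vector k} {V : Fin m → Vector k}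
    → Independent V → Dependent (x ∷ V) → x ∈Span V
  dependent-∷⇒∈Span {x = x} {V} ind (a , a≢0 , rel) with a zero ≟ 0#
  ... | yes a₀≈0 = ⊥-elim (a≢0 (∷-relation-trivial ind a rel a₀≈0))
  ... | no a₀≉0 with inverse (a zero) a₀≉0
  ... | u , a₀u≈1 = (λ l → - u * a (suc l)) , λ i → begin
    x i                                  ≈⟨ *-identityˡ (x i) ⟨
    1# * x i                             ≈⟨ *-congʳ (trans (*-comm u (a zero)) a₀u≈1) ⟨
    (u * a zero) * x i                   ≈⟨ *-assoc u (a zero) (x i) ⟩
    u * (a zero * x i)                   ≈⟨ *-congˡ (inverseˡ-unique _ _ (rel i)) ⟩
    u * - lincomb (a ∘ suc) V i          ≈⟨ -‿distribʳ-* u _ ⟨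
    - (u * lincomb (a ∘ suc) V i)        ≈⟨ -‿distribˡ-* u _ ⟩
    - u * lincomb (a ∘ suc) V i          ≈⟨ lincomb-* (- u) (a ∘ suc) V i ⟨
    lincomb (λ l → - u * a (suc l)) V i  ∎

  ∈Span-annihilated : ∀ {m k} {a x : Vector k} {V : Fin m → Vector k}
    → x ∈Span V → (∀ l → a · V l ≈ 0#) → a · x ≈ 0#
  ∈Span-annihilated {a = a} {x} {V} (b , x≈bV) a⊥V = begin
    a · x                ≈⟨ sumF-cong (λ i → *-congˡ (x≈bV i)) ⟩
    a · lincomb b V      ≈⟨ ·-lincomb a b V ⟩
    b · (λ l → a · V l)  ≈⟨ ·-zeroʳ b a⊥V ⟩
    0#                   ∎

  annihilated-∷-independent : ∀ {m k} {a x : Vector k} {V : Fin m → Vector k}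
    → Independent V → (∀ l → a · V l ≈ 0#) → ¬ a · x ≈ 0# → Independent (x ∷ V)
  annihilated-∷-independent {a = a} {x} {V} ind a⊥V a·x≉0 c rel =
    ∷-relation-trivial ind c rel (x*y≈0⇒x≈0 a·x≉0 c₀[a·x]≈0)
    where
    c₀[a·x]≈0 : c zero * (a · x) ≈ 0#
    c₀[a·x]≈0 = begin
      c zero * (a · x)           ≈⟨ +-identityʳ _ ⟨
      c zero * (a · x) + 0#      ≈⟨ +-congˡ (·-zeroʳ (c ∘ suc) a⊥V) ⟨
      c · (λ l → a · (x ∷ V) l)  ≈⟨ ·-lincomb a c (x ∷ V) ⟨
      a · lincomb c (x ∷ V)      ≈⟨ ·-zeroʳ a rel ⟩
      0#                         ∎

  -- One elimination step: clear coordinate i₀ of the other vectors using the pivot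
  -- entry V zero i₀, then delete that coordinate.
  module Elimination {m k} (V : Fin (suc m) → Vector (suc k)) (i₀ : Fin (suc k))
    {u : Carrier} (pu≈1 : V zero i₀ * u ≈ 1#) where

    factor : Vector m
    factor l = - (V (suc l) i₀ * u)

    U : Fin m → Vector (suc k)
    U l i = V (suc l) i + factor l * V zero i

    U-pivot≈0 : ∀ l → U l i₀ ≈ 0#
    U-pivot≈0 l = begin
      x + - (x * u) * p    ≈⟨ +-congˡ (-‿distribˡ-* (x * u) p) ⟨
      x + - ((x * u) * p)  ≈⟨ +-congˡ (-‿cong [xu]p≈x) ⟩
      x + - x              ≈⟨ -‿inverseʳ x ⟩
      0#                   ∎
      where
      x p : Carrier
      x = V (suc l) i₀
      p = V zero i₀
      [xu]p≈x : (x * u) * p ≈ x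
      [xu]p≈x = trans (*-assoc x u p)
                (trans (*-congˡ (trans (*-comm u p) pu≈1)) (*-identityʳ x))

    lincomb-U : ∀ c i → lincomb c U i ≈ lincomb (c · factor ∷ c) V i
    lincomb-U c i = begin
      sumF (λ l → c l * (V (suc l) i + factor l * V zero i))
        ≈⟨ sumF-cong (λ l → trans (distribˡ (c l) _ _) (+-congˡ (sym (*-assoc (c l) (factor l) _)))) ⟩
      sumF (λ l → c l * V (suc l) i + (c l * factor l) * V zero i)
        ≈⟨ sumF-+ (λ l → c l * V (suc l) i) (λ l → (c l * factor l) * V zero i) ⟩
      lincomb c (V ∘ suc) i + sumF (λ l → (c l * factor l) * V zero i)
        ≈⟨ +-congˡ (sumF-*ʳ (V zero i) (λ l → c l * factor l)) ⟩
      lincomb c (V ∘ suc) i + (c · factor) * V zero i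
        ≈⟨ +-comm _ _ ⟩
      (c · factor) * V zero i + lincomb c (V ∘ suc) i
        ∎

    W : Fin m → Vector k
    W l = U l ∘ punchIn i₀

    W-independent : Independent V → Independent W
    W-independent ind c cW≈0 l = ind (c · factor ∷ c) cV≈0 (suc l)
      where
      cU≈0 : IsZero (lincomb c U)
      cU≈0 = punchIn-cases i₀ (·-zeroʳ c U-pivot≈0) cW≈0
      cV≈0 : IsZero (lincomb (c · factor ∷ c) V)
      cV≈0 i = trans (sym (lincomb-U c i)) (cU≈0 i)

  independent⇒≤ : ∀ {m k} {V : Fin m → Vector k} → Independent V → m ≤ k
  independent⇒≤ {zero}               _   = z≤n
  independent⇒≤ {suc m} {zero}  {V} ind = ⊥-elim (independent⇒nonzero {V = V} ind zero (λ ()))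
  independent⇒≤ {suc m} {suc k} {V} ind
    with ¬∀⟶∃¬ _ _ (λ i → V zero i ≟ 0#) (independent⇒nonzero {V = V} ind zero)
  ... | i₀ , p≉0 with inverse (V zero i₀) p≉0
  ... | u , pu≈1 = s≤s (independent⇒≤ (Elimination.W-independent V i₀ pu≈1 ind))

  private module CarrierSearch = FiniteSearch setoid enum enum-surj

  dependent? : ∀ {m k} (V : Fin m → Vector k) → Dec (Dependent V)
  dependent? {m} V = CarrierSearch.∃-vector? m respects
    (λ a → ¬? (all? (λ l → a l ≟ 0#)) ×-dec all? (λ i → lincomb a V i ≟ 0#))
    where
    respects : ∀ {a b} → (∀ l → a l ≈ b l)
      → NonZeroVec a × IsZero (lincomb a V) → NonZeroVec b × IsZero (lincomb b V)
    respects a≈b (a≢0 , aV≈0) =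
      (λ b≈0 → a≢0 (λ l → trans (a≈b l) (b≈0 l))) ,
      (λ i → trans (sym (lincomb-cong V a≈b i)) (aV≈0 i))

  independent⊎dependent : ∀ {m k} (V : Fin m → Vector k) → Independent V ⊎ Dependent V
  independent⊎dependent V with dependent? V
  ... | yes dep  = inj₂ dep
  ... | no ¬dep = inj₁ λ a aV≈0 →
    decidable-stable (all? (λ l → a l ≟ 0#)) (λ a≢0 → ¬dep (a , a≢0 , aV≈0))

  >⇒dependent : ∀ {m k} (V : Fin m → Vector k) → k < m → Dependent V
  >⇒dependent V k<m =
    [ (λ ind → ⊥-elim (ℕ.<⇒≱ k<m (independent⇒≤ ind))) , (λ dep → dep) ]′ (independent⊎dependent V)

  independent? : ∀ {m k} (V : Fin m → Vector k) → Dec (Independent V)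
  independent? V = [ yes , (λ (a , a≢0 , aV≈0) → no (λ ind → a≢0 (ind a aV≈0))) ]′
    (independent⊎dependent V)

  VanishesOn : ∀ {n} → Vector n → Subset n → Set ℓ
  VanishesOn v X = ∀ j → j ∈ X → v j ≈ 0#

  vanishes-on-both⇒zero : ∀ {n} {v : Vector n} {X}
    → VanishesOn v X → VanishesOn v (∁ X) → IsZero v
  vanishes-on-both⇒zero {X = X} v⊥X v⊥∁X j with j ∈? X
  ... | yes j∈X = v⊥X j j∈X
  ... | no  j∉X = v⊥∁X j (x∉p⇒x∈∁p j∉X)

  zeros : ∀ {n} → Vector n → Subset n
  zeros v = tabulate (λ j → isYes (v j ≟ 0#))

  vanishes-on-zeros : ∀ {n} (v : Vector n) → VanishesOn v (zeros v)
  vanishes-on-zeros v j j∈zeros = toWitness (Equivalence.from T-≡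
    (≡.trans (≡.sym (lookup∘tabulate _ j)) ([]=⇒lookup j∈zeros)))

  ≈0⇒∈zeros : ∀ {n} (v : Vector n) {j} → v j ≈ 0# → j ∈ zeros v
  ≈0⇒∈zeros v {j} vj≈0 = lookup⇒[]= j (zeros v)
    (≡.trans (lookup∘tabulate _ j) (Equivalence.to T-≡ (fromWitness vj≈0)))

  supportsMeet? : ∀ {n} (v w : Vector n) → Dec (SupportsMeet v w)
  supportsMeet? v w = any? (λ i → ¬? (v i ≟ 0#) ×-dec ¬? (w i ≟ 0#))

  vanishing-on-complements⇒¬SupportsMeet : ∀ {n} {v w : Vector n} {X}
    → VanishesOn v X → VanishesOn w (∁ X) → ¬ SupportsMeet v w
  vanishing-on-complements⇒¬SupportsMeet {X = X} v⊥X w⊥∁X (j , vj≉0 , wj≉0)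
    with j ∈? X
  ... | yes j∈X = vj≉0 (v⊥X j j∈X)
  ... | no  j∉X = wj≉0 (w⊥∁X j (x∉p⇒x∈∁p j∉X))

  ¬SupportsMeet⇒vanishes-off-zeros : ∀ {n} {v w : Vector n}
    → ¬ SupportsMeet v w → VanishesOn w (∁ (zeros v))
  ¬SupportsMeet⇒vanishes-off-zeros {v = v} {w} disjoint j j∈∁zeros =
    decidable-stable (w j ≟ 0#) λ wj≉0 →
      disjoint (j , (λ vj≈0 → x∈∁p⇒x∉p j∈∁zeros (≈0⇒∈zeros v vj≈0)) , wj≉0)

module ColumnMatroid {c ℓ} (F : FiniteField c ℓ) {k n} (G : Code.Matrix F k n) where

  open FiniteField F hiding (zero)
  open Code F
  open LinearAlgebra F

  -- The entry (lincomb a G) j of the codeword aG is definitionally a · column j, and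
  -- ColumnsIndependent G js is definitionally Independent (column ∘ js).
  column : Fin n → Vector k
  column j i = G i j

  private module IndexSearch = FiniteSearch (≡.setoid (Fin n)) (λ j → j) (λ j → j , ≡.refl)

  indepFamilyIn? : ∀ X m → Dec (IndepFamilyIn G X m)
  indepFamilyIn? X m = IndexSearch.∃-vector? m respects (λ js →
    all? (λ l → all? (λ l′ → (js l Fin.≟ js l′) →-dec (l Fin.≟ l′)))
    ×-dec all? (λ l → js l ∈? X) ×-dec independent? (column ∘ js))
    where
    respects : ∀ {js js′} → (∀ l → js l ≡ js′ l)
      → (∀ l l′ → js l ≡ js l′ → l ≡ l′) × (∀ l → js l ∈ X) × ColumnsIndependent G js
      → (∀ l l′ → js′ l ≡ js′ l′ → l ≡ l′) × (∀ l → js′ l ∈ X) × ColumnsIndependent G js′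
    respects {js} {js′} js≗js′ (injective , ∈X , ind) =
      (λ l l′ eq → injective l l′ (≡.trans (js≗js′ l) (≡.trans eq (≡.sym (js≗js′ l′))))) ,
      (λ l → ≡.subst (_∈ X) (js≗js′ l) (∈X l)) ,
      (λ a aV≈0 → ind a (λ i → trans (lincomb-cong′ i) (aV≈0 i)))
      where
      lincomb-cong′ : ∀ {a} i → lincomb a (column ∘ js) i ≈ lincomb a (column ∘ js′) i
      lincomb-cong′ i = sumF-cong (λ l → *-congˡ (reflexive (≡.cong (G i) (js≗js′ l))))

  indepFamilyIn⇒≤rows : ∀ {X m} → IndepFamilyIn G X m → m ≤ k
  indepFamilyIn⇒≤rows (js , _ , _ , ind) = independent⇒≤ {V = column ∘ js} ind

  rank-exists : ∀ X → ∃ (IsRank G X)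
  rank-exists X = greatest-below (indepFamilyIn? X) empty-family k (λ _ → indepFamilyIn⇒≤rows)
    where
    empty-family : IndepFamilyIn G X 0
    empty-family = (λ ()) , (λ ()) , (λ ()) , (λ _ _ ())

  basis : ∀ {X r} → IsRank G X r → Fin r → Fin n
  basis ((js , _) , _) = js

  basis-spans : ∀ {X r} (R : IsRank G X r) {j} → j ∈ X → column j ∈Span (column ∘ basis R)
  basis-spans {X} {r} ((js , injective , ∈X , ind) , maximal) {j} j∈X
    with any? (λ l → j Fin.≟ js l)
  ... | yes (l , ≡.refl) = δ l , λ i → sym (lincomb-δ l (column ∘ js) i)
  ... | no j∉js = dependent-∷⇒∈Span ind j∷basis-dependent
    where
    injective′ : ∀ l l′ → (j ∷ js) l ≡ (j ∷ js) l′ → l ≡ l′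
    injective′ zero     zero      _  = ≡.refl
    injective′ zero     (suc l′)  eq = ⊥-elim (j∉js (l′ , eq))
    injective′ (suc l)  zero      eq = ⊥-elim (j∉js (l , ≡.sym eq))
    injective′ (suc l)  (suc l′)  eq = ≡.cong suc (injective l l′ eq)
    ∈X′ : ∀ l → (j ∷ js) l ∈ X
    ∈X′ zero    = j∈X
    ∈X′ (suc l) = ∈X l
    j∷basis-dependent : Dependent (column j ∷ column ∘ js)
    j∷basis-dependent =
      [ (λ ind′ → ⊥-elim (ℕ.n≮n r (maximal (suc r) (j ∷ js , injective′ , ∈X′ , ind′)))) ,
        (λ dep → dep) ]′ (independent⊎dependent (column ∘ (j ∷ js)))

  rank<⇒annihilator : ∀ {X r} → IsRank G X r → r < k
    → ∃ λ a → NonZeroVec a × VanishesOn (lincomb a G) X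
  rank<⇒annihilator R r<k with >⇒dependent (λ i l → G i (basis R l)) r<k
  ... | a , a≢0 , a⊥basis = a , a≢0 , λ j j∈X → ∈Span-annihilated (basis-spans R j∈X) a⊥basis

  annihilator⇒rank< : ∀ {X r a}
    → NonZeroVec a → VanishesOn (lincomb a G) X → IsRank G X r → r < k
  annihilator⇒rank< {a = a} a≢0 a⊥X ((js , _ , ∈X , ind) , _)
    with ¬∀⟶∃¬ _ _ (λ i → a i ≟ 0#) a≢0
  ... | i₀ , aᵢ₀≉0 = independent⇒≤ {V = δ i₀ ∷ column ∘ js}
      (annihilated-∷-independent ind (λ l → a⊥X (js l) (∈X l)) (aᵢ₀≉0 ∘ trans (sym (·-δ a i₀))))

  rank0⇒vanishes : ∀ {X} a → IsRank G X 0 → VanishesOn (lincomb a G) X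
  rank0⇒vanishes a R j j∈X =
    ∈Span-annihilated {a = a} {V = column ∘ basis R} (basis-spans R j∈X) (λ ())

  independent-rows⇒rank≡rows : Independent G → ∀ {r} → IsRank G ⊤ r → r ≡ k
  independent-rows⇒rank≡rows ind R with ℕ.m≤n⇒m<n∨m≡n (indepFamilyIn⇒≤rows (proj₁ R))
  ... | inj₂ r≡k = r≡k
  ... | inj₁ r<k with rank<⇒annihilator R r<k
  ... | a , a≢0 , a⊥E = ⊥-elim (a≢0 (ind a (λ j → a⊥E j ∈⊤)))

  independent-rows⇒IsRank⊤ : Independent G → IsRank G ⊤ k
  independent-rows⇒IsRank⊤ ind with rank-exists ⊤
  ... | r , R = ≡.subst (IsRank G ⊤) (independent-rows⇒rank≡rows ind R) R

  ComplementaryCodewords : Subset n → Set (c ⊔ ℓ)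
  ComplementaryCodewords X = ∃₂ λ a b → NonZeroVec (lincomb a G) × NonZeroVec (lincomb b G)
    × VanishesOn (lincomb a G) X × VanishesOn (lincomb b G) (∁ X)

  separation⇒complementary : Independent G → ∀ {X t}
    → IsVerticalSeparation G X t → ComplementaryCodewords X
  separation⇒complementary ind (_ , _ , _ , _ , RX , RY , RE , connectivity<t , t≤rX , t≤rY)
    with independent-rows⇒rank≡rows ind RE
  ... | ≡.refl with x+y∸e<t⇒x<e×y<e t≤rX t≤rY connectivity<t
  ... | rX<k , rY<k with rank<⇒annihilator RX rX<k | rank<⇒annihilator RY rY<k
  ... | a , a≢0 , a⊥X | b , b≢0 , b⊥∁X =
    a , b , (λ aG≈0 → a≢0 (ind a aG≈0)) , (λ bG≈0 → b≢0 (ind b bG≈0)) , a⊥X , b⊥∁X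

  complementary⇒separation : Independent G → ∀ {X}
    → ComplementaryCodewords X → ∃ (IsVerticalSeparation G X)
  complementary⇒separation ind {X} (a , b , aG≢0 , bG≢0 , a⊥X , b⊥∁X)
    with rank-exists X | rank-exists (∁ X)
  ... | rX , RX | rY , RY =
    rX ⊓ rY , ⊓-glb 1≤rX 1≤rY , rX , rY , k , RX , RY , independent-rows⇒IsRank⊤ ind ,
    x+y∸e<x⊓y 1≤rX 1≤rY rX<k rY<k , m⊓n≤m rX rY , m⊓n≤n rX rY
    where
    rX<k : rX < k
    rX<k = annihilator⇒rank< (aG≢0 ∘ lincomb-zeroˡ G) a⊥X RX
    rY<k : rY < k
    rY<k = annihilator⇒rank< (bG≢0 ∘ lincomb-zeroˡ G) b⊥∁X RY
    1≤rX : 1 ≤ rX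
    1≤rX = ℕ.n≢0⇒n>0 λ { ≡.refl → bG≢0 (vanishes-on-both⇒zero (rank0⇒vanishes b RX) b⊥∁X) }
    1≤rY : 1 ≤ rY
    1≤rY = ℕ.n≢0⇒n>0 λ { ≡.refl → aG≢0 (vanishes-on-both⇒zero a⊥X (rank0⇒vanishes a RY)) }

  separation⇒<rows : ∀ {X t} → IsVerticalSeparation G X t → t < k
  separation⇒<rows (_ , rX , _ , rE , _ , _ , RE , connectivity<t , t≤rX , t≤rY) =
    ≤-<-trans t≤rX (<-≤-trans rX<rE (indepFamilyIn⇒≤rows (proj₁ RE)))
    where
    rX<rE : rX < rE
    rX<rE = proj₁ (x+y∸e<t⇒x<e×y<e t≤rX t≤rY connectivity<t)

  no-complementary⇔no-separation : Independent G
    → (∀ X → ¬ ComplementaryCodewords X) ⇔ (∀ t → ¬ HasVerticalSeparation G t)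
  no-complementary⇔no-separation ind = mk⇔
    (λ none t (X , sep) → none X (separation⇒complementary ind sep))
    (λ none X comp → none _ (X , proj₂ (complementary⇒separation ind comp)))

  no-separation⇔connectivity≡rows : Independent G
    → (∀ t → ¬ HasVerticalSeparation G t) ⇔ IsVerticalConnectivity G k
  no-separation⇔connectivity≡rows ind = mk⇔
    (λ none → inj₂ (none , independent-rows⇒IsRank⊤ ind))
    (λ { (inj₁ ((_ , sep) , _)) → ⊥-elim (ℕ.n≮n k (separation⇒<rows sep))
       ; (inj₂ (none , _))       → none })

module IntersectingCode {c ℓ} (F : FiniteField c ℓ) {p n k}
  (C : Code.Subspace F {p} n) (G : Code.Matrix F k n) where

  open FiniteField F hiding (zero)
  open Code F
  open Subspace C
  open LinearAlgebra F
  open ColumnMatroid F G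

  intersecting⇔no-complementary : (∀ v → (Mem v → InRowSpan G v) × (InRowSpan G v → Mem v))
    → Intersecting C ⇔ (∀ X → ¬ ComplementaryCodewords X)
  intersecting⇔no-complementary spans = mk⇔
    (λ int X (a , b , aG≢0 , bG≢0 , a⊥X , b⊥∁X) →
      vanishing-on-complements⇒¬SupportsMeet a⊥X b⊥∁X (int _ _ (codeword a) (codeword b) aG≢0 bG≢0))
    (λ none v w v∈C w∈C v≢0 w≢0 → decidable-stable (supportsMeet? v w) λ disjoint →
      none (zeros v) (complementary v w v∈C w∈C v≢0 w≢0 disjoint))
    where
    codeword : ∀ a → Mem (lincomb a G)
    codeword a = proj₂ (spans (lincomb a G)) (a , λ _ → refl)
    complementary : ∀ v w → Mem v → Mem w → NonZeroVec v → NonZeroVec w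
      → ¬ SupportsMeet v w → ComplementaryCodewords (zeros v)
    complementary v w v∈C w∈C v≢0 w≢0 disjoint
      with proj₁ (spans v) v∈C | proj₁ (spans w) w∈C
    ... | a , v≈aG | b , w≈bG =
      a , b , nonzero v≈aG v≢0 , nonzero w≈bG w≢0 ,
      vanishes v≈aG (vanishes-on-zeros v) , vanishes w≈bG (¬SupportsMeet⇒vanishes-off-zeros disjoint)
      where
      nonzero : ∀ {v a} → (∀ j → v j ≈ lincomb a G j) → NonZeroVec v → NonZeroVec (lincomb a G)
      nonzero v≈aG v≢0 aG≈0 = v≢0 (λ j → trans (v≈aG j) (aG≈0 j))
      vanishes : ∀ {v a X} → (∀ j → v j ≈ lincomb a G j) → VanishesOn v X → VanishesOn (lincomb a G) X
      vanishes v≈aG v⊥X j j∈X = trans (sym (v≈aG j)) (v⊥X j j∈X)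

theorem4p13 : ∀ {c ℓ p : Level} (F : FiniteField c ℓ) (n : ℕ)
    (C : Code.Subspace F {p} n) (k : ℕ) (G : Code.Matrix F k n)
    → Code.IsGeneratorMatrix F C G
    → (Code.Intersecting F C ⇔ Code.IsVerticalConnectivity F G k)
theorem4p13 F n C k G (rows-independent , spans) =
  no-separation⇔connectivity≡rows rows-independent ⇔-∘
  (no-complementary⇔no-separation rows-independent ⇔-∘ intersecting⇔no-complementary spans)
  where
  open ColumnMatroid F G
  open IntersectingCode F C G
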